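{- For every $n\in\mathbb{N}$, $\gamma(\mathcal{Q}(n+1))\le\gamma(\mathcal{Q}(n))+1$.
   Context: The $n$-Queens' graph $\mathcal{Q}(n)$ has vertex set $[n]^2$ (squares of an $n\times n$ chessboard); two distinct vertices $(i,j),(p,q)$ are adjacent iff $i=p$, or $j=q$, or $i+j=p+q$, or $i-j=p-q$. $\gamma(G)$ is the domination number: the minimum size of a set $S\subseteq V(G)$ such that every vertex is in $S$ or adjacent to a vertex of $S$. -}

module Defs where

open import Data.Nat using (ℕ; _+_; _≤_)
open import Data.Fin using (Fin; toℕ)
open import Data.Product using (_×_; _,_; ∃-syntax)
open import Data.Sum using (_⊎_)
open import Data.List using (List; length)
open import Data.List.Membership.Propositional using (_∈_)
open import Data.List.Relation.Unary.Any using (Any)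
open import Data.List.Relation.Unary.Unique.Propositional using (Unique)
open import Relation.Binary.PropositionalEquality using (_≡_)
open import Relation.Nullary using (¬_)

-- Squares of the n × n board (coordinates 0..n-1; [n] = {1..n} shifted by one).
Square : ℕ → Set
Square n = Fin n × Fin n

-- Adjacency in the n-Queens' graph Q(n): distinct squares sharing a row,
-- a column, an anti-diagonal (i+j = p+q) or a diagonal (i-j = p-q,
-- written over ℕ as i+q = p+j).
QAdj : (n : ℕ) → Square n → Square n → Set
QAdj n (i , j) (p , q) =
  ¬ ((i , j) ≡ (p , q)) ×
  (i ≡ p ⊎ j ≡ q ⊎ toℕ i + toℕ j ≡ toℕ p + toℕ q ⊎ toℕ i + toℕ q ≡ toℕ p + toℕ j)

Dominating : (n : ℕ) → List (Square n) → Set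
Dominating n S = Unique S × (∀ (v : Square n) → v ∈ S ⊎ Any (λ u → QAdj n u v) S)

IsDominationNumber : ℕ → ℕ → Set
IsDominationNumber n k =
  (∃[ S ] (Dominating n S × length S ≡ k)) ×
  (∀ S → Dominating n S → k ≤ length S)

{-# OPTIONS --safe #-}
-- Put a dominating set of Q(n) in the top-left n × n corner of the (n+1) × (n+1)
-- board: queen lines between old squares are unchanged, and one extra queen on the
-- new corner square (n, n) covers the new last row and last column.
module Submission where

open import Defs
open import Data.Nat using (ℕ; zero; suc; _+_; _≤_)
open import Data.Nat.Properties using (+-comm; ≤-trans; ≤-reflexive)
open import Data.Fin using (Fin; fromℕ; inject₁)
open import Data.Fin.Properties using (toℕ-inject₁; inject₁-injective; fromℕ≢inject₁)
open import Data.Product using (_,_; proj₁; proj₂)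
open import Data.Sum using (_⊎_; inj₁; inj₂)
import Data.Sum as Sum
open import Data.List using (List; _∷_; map; length)
open import Data.List.Properties using (length-map)
open import Data.List.Membership.Propositional.Properties using (∈-map⁺)
open import Data.List.Membership.Propositional using (_∈_)
open import Data.List.Relation.Unary.Any using (Any; here; there)
import Data.List.Relation.Unary.Any as Any
import Data.List.Relation.Unary.Any.Properties as Any
import Data.List.Relation.Unary.All as All
import Data.List.Relation.Unary.All.Properties as All
open import Data.List.Relation.Unary.AllPairs using (_∷_)
open import Data.List.Relation.Unary.Unique.Propositional using (Unique)
import Data.List.Relation.Unary.Unique.Propositional.Properties as Unique
open import Function using (id; _∘_)
open import Relation.Binary.PropositionalEquality using (_≡_; refl; cong; cong₂; trans; module ≡-Reasoning)

data Inject₁OrLast : ∀ {n} → Fin (suc n) → Set where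
  inject : ∀ {n} (i : Fin n) → Inject₁OrLast (inject₁ i)
  last   : ∀ {n} → Inject₁OrLast (fromℕ n)

inject₁-or-last : ∀ {n} (i : Fin (suc n)) → Inject₁OrLast i
inject₁-or-last {zero}  Fin.zero    = last
inject₁-or-last {suc n} Fin.zero    = inject Fin.zero
inject₁-or-last {suc n} (Fin.suc i) with inject₁-or-last i
... | inject j = inject (Fin.suc j)
... | last     = last

embed : ∀ {n} → Square n → Square (suc n)
embed (i , j) = inject₁ i , inject₁ j

embed-injective : ∀ {n} {u v : Square n} → embed u ≡ embed v → u ≡ v
embed-injective eq = cong₂ _,_ (inject₁-injective (cong proj₁ eq)) (inject₁-injective (cong proj₂ eq))

QAdj-embed : ∀ {n} {u v : Square n} → QAdj n u v → QAdj (suc n) (embed u) (embed v)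
QAdj-embed {u = i , j} {p , q} (u≢v , line)
  rewrite toℕ-inject₁ i | toℕ-inject₁ j | toℕ-inject₁ p | toℕ-inject₁ q
  = u≢v ∘ embed-injective , Sum.map (cong inject₁) (Sum.map (cong inject₁) id) line

corner : ∀ n → Square (suc n)
corner n = fromℕ n , fromℕ n

dominating-suc : ∀ {n} {S : List (Square n)} →
                 Dominating n S → Dominating (suc n) (corner n ∷ map embed S)
dominating-suc {n} {S} (unique , dominated) = unique′ , dominated′
  where
  unique′ : Unique (corner n ∷ map embed S)
  unique′ = All.map⁺ (All.tabulate (λ _ → fromℕ≢inject₁ ∘ cong proj₁))
          ∷ Unique.map⁺ embed-injective unique

  dominated′ : ∀ v → v ∈ (corner n ∷ map embed S) ⊎ Any (λ u → QAdj (suc n) u v) (corner n ∷ map embed S)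
  dominated′ (i , j) with inject₁-or-last i | inject₁-or-last j
  ... | last     | last     = inj₁ (here refl)
  ... | last     | inject q = inj₂ (here (fromℕ≢inject₁ ∘ cong proj₂ , inj₁ refl))
  ... | inject p | last     = inj₂ (here (fromℕ≢inject₁ ∘ cong proj₁ , inj₂ (inj₁ refl)))
  ... | inject p | inject q =
    Sum.map (there ∘ ∈-map⁺ embed) (there ∘ Any.map⁺ ∘ Any.map QAdj-embed) (dominated (p , q))

proposition2 : ∀ (n a b : ℕ) → IsDominationNumber n a → IsDominationNumber (suc n) b → b ≤ a + 1
proposition2 n a b ((S , S-dominating , |S|≡a) , _) (_ , b-minimal) =
  ≤-trans (b-minimal _ (dominating-suc S-dominating)) (≤-reflexive size)
  where
  open ≡-Reasoning
  size : length (corner n ∷ map embed S) ≡ a + 1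
  size = begin
    suc (length (map embed S)) ≡⟨ cong suc (trans (length-map embed S) |S|≡a) ⟩
    suc a                      ≡⟨ +-comm 1 a ⟩
    a + 1                      ∎
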